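{- Let $C$ be a 2-complex in which every edge is incident with at least three faces. Then $C$ admits a planar rotation system if and only if $C$ admits an even rotation framework.
   Context: A 2-complex $C=(V,E,F)$ is a finite graph (loops and parallel edges allowed) with a finite set $F$ of faces, each a closed trail; it is directed (edges have directions, faces orientations). The link graph $L(v)$ has as vertices the edges at $v$ (a loop contributes two) and, for each traversal of $v$ by a face, an edge joining the vertices corresponding to the face's edges just before and after the traversal. For an edge $e$, the edges of $L(v)$ at the vertex $e$ (for $v$ an endvertex) correspond to the faces incident with $e$. A rotation system of a graph assigns to each vertex a cyclic orientation (rotator) of its incident edges; it is planar if the oriented surface obtained by gluing discs along facial walks is a disjoint union of 2-spheres. A rotation system of $C$ is a family $(\sigma_e)_{e\in E}$, $\sigma_e$ a cyclic orientation of the faces at $e$; it induces on $L(v)$ the rotator $\sigma_e$ at $e$ if $e$ is directed towards $v$ and the reverse otherwise; it is planar if all induced rotation systems of link graphs are planar. A rotation framework of $C$ is a choice of a planar rotation system of every link graph of $C$ such that for every edge $e=vw$ the two rotators at $e$ (as a vertex of $L(v)$ and of $L(w)$, both viewed as cyclic orientations of the faces at $e$) are either equal or reverse. An edge is green if these two rotators are reverse and red otherwise. The rotation framework is even if every cycle of (the 1-skeleton of) $C$ contains an even number of red edges. -}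

module Defs where

open import Data.Nat using (ℕ; zero; suc; _+_; _*_; _≤_)
open import Data.Nat.DivMod using (_mod_)
open import Data.Bool using (Bool; true; false; not; T; _∧_; _∨_; if_then_else_)
open import Data.Bool.Properties using (T?)
open import Data.Fin using (Fin; toℕ)
import Data.Fin as Fin
open import Data.Fin.Properties using (any?)
open import Data.Product using (Σ; Σ-syntax; _×_; _,_; proj₁; proj₂; ∃)
open import Data.Product.Properties using (≡-dec)
open import Data.Product.Relation.Binary.Pointwise.NonDependent using ()
open import Data.Sum using (_⊎_)
open import Data.Empty using (⊥-elim)
open import Data.List using (List; []; _∷_; length; filter; cartesianProduct; deduplicate; allFin)
import Data.List as List
import Data.Bool.ListAction as BL
open import Data.List.Membership.Propositional using (_∈_)
open import Data.List.Membership.Propositional.Properties using (∈-allFin; ∈-cartesianProduct⁺)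
open import Data.List.Relation.Unary.Any using (here; there)
import Data.List.Relation.Unary.Any as Any
open import Relation.Binary.PropositionalEquality
open import Relation.Binary using (DecidableEquality)
open import Relation.Nullary using (¬_; Dec; yes; no; ¬?)
open import Relation.Nullary.Decidable using (⌊_⌋; _×-dec_)
open import Relation.Unary using (Decidable)
open import Axiom.UniquenessOfIdentityProofs using (module Decidable⇒UIP)

iterate : {A : Set} → (A → A) → ℕ → A → A
iterate f zero a = a
iterate f (suc k) a = f (iterate f k a)

next : {n : ℕ} → Fin (suc n) → Fin (suc n)
next {n} i = suc (toℕ i) mod (suc n)

-- f is a "cyclic orientation on each class of cls": f maps every class
-- to itself, is injective, and any two elements of a class lie on one
-- f-orbit (so f restricted to each class is a single cycle).
record IsCyclicOn {A B : Set} (f : A → A) (cls : A → B) : Set where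
  field
    preserves  : ∀ a → cls (f a) ≡ cls a
    injective  : ∀ a a' → f a ≡ f a' → a ≡ a'
    transitive : ∀ a a' → cls a ≡ cls a' → Σ ℕ (λ k → iterate f k a ≡ a')

record Finite (A : Set) : Set where
  field
    _≟_      : DecidableEquality A
    elems    : List A
    complete : ∀ a → a ∈ elems

finiteFin : (n : ℕ) → Finite (Fin n)
finiteFin n = record { _≟_ = Fin._≟_ ; elems = allFin n ; complete = ∈-allFin }

finiteBool : Finite Bool
finiteBool = record { _≟_ = Data.Bool._≟_ ; elems = false ∷ true ∷ [] ; complete = c }
  where
  c : ∀ b → b ∈ (false ∷ true ∷ [])
  c false = here refl
  c true  = there (here refl)

finite× : {A B : Set} → Finite A → Finite B → Finite (A × B)
finite× FA FB = record
  { _≟_ = ≡-dec (Finite._≟_ FA) (Finite._≟_ FB)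
  ; elems = cartesianProduct (Finite.elems FA) (Finite.elems FB)
  ; complete = λ { (a , b) → ∈-cartesianProduct⁺ (Finite.complete FA a) (Finite.complete FB b) } }

module _ {A : Set} (FA : Finite A) (P : A → Set) (P? : Decidable P)
         (irr : ∀ {a} (p q : P a) → p ≡ q) where
  private
    sub : List A → List (Σ A P)
    sub [] = []
    sub (x ∷ xs) with P? x
    ... | yes p = (x , p) ∷ sub xs
    ... | no _  = sub xs

    sub-complete : ∀ {a} (p : P a) xs → a ∈ xs → (a , p) ∈ sub xs
    sub-complete {a} p (x ∷ xs) (here refl) with P? x
    ... | yes q = here (cong (a ,_) (irr p q))
    ... | no ¬q = ⊥-elim (¬q p)
    sub-complete p (x ∷ xs) (there m) with P? x
    ... | yes q = there (sub-complete p xs m)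
    ... | no _  = sub-complete p xs m

  finiteΣ : Finite (Σ A P)
  finiteΣ = record
    { _≟_ = ≡-dec (Finite._≟_ FA) (λ p q → yes (irr p q))
    ; elems = sub (Finite.elems FA)
    ; complete = λ { (a , p) → sub-complete p (Finite.elems FA) (Finite.complete FA a) } }

-- Graphs (finite, loops and parallel edges allowed), given by a vertex
-- type, an edge type, and the two ends of every edge.

record Graph : Set₁ where
  field
    V E  : Set
    finV : Finite V
    finE : Finite E
    end  : E → Bool → V

module GraphTheory (G : Graph) where
  open Graph G

  -- darts (half-edges); a loop contributes two darts at its vertex
  Dart : Set
  Dart = E × Bool

  finD : Finite Dart
  finD = finite× finE finiteBool

  vert : Dart → V
  vert (e , b) = end e b

  θ : Dart → Dart
  θ (e , b) = (e , not b)

  private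
    _≟V_ = Finite._≟_ finV
    _≟E_ = Finite._≟_ finE
    _≟D_ = Finite._≟_ finD
    Vs = Finite.elems finV
    Es = Finite.elems finE
    Ds = Finite.elems finD

  record Rotation : Set where
    field
      σ      : Dart → Dart
      cyclic : IsCyclicOn σ vert

  numVertices : ℕ
  numVertices = length (deduplicate _≟V_ Vs)

  numEdges : ℕ
  numEdges = length (deduplicate _≟E_ Es)

  -- connectivity by walks (bounded search, length ≤ |Vs| suffices)
  reach : ℕ → V → V → Bool
  reach zero u w = ⌊ u ≟V w ⌋
  reach (suc k) u w = reach k u w ∨ BL.any (λ d → reach k u (vert d) ∧ ⌊ vert (θ d) ≟V w ⌋) Ds

  Connected : V → V → Set
  Connected u w = T (reach (length Vs) u w)

  numComponents : ℕ
  numComponents = length (deduplicate {R = Connected} (λ u w → T? (reach (length Vs) u w)) Vs)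

  -- isolated vertices (each is conventionally one spherical component with one face)
  numIsolated : ℕ
  numIsolated = length (filter (λ v → ¬? (Any.any? (λ d → vert d ≟V v) Ds)) (deduplicate _≟V_ Vs))

  -- facial walks of a rotation system = orbits of σ ∘ θ on darts
  -- (a permutation orbit has length ≤ |Ds|, so exponents k < |Ds| suffice)
  SameFace : Rotation → Dart → Dart → Set
  SameFace R d d' = Σ (Fin (length Ds)) (λ k → iterate (λ x → Rotation.σ R (θ x)) (toℕ k) d ≡ d')

  numFaces : Rotation → ℕ
  numFaces R = length (deduplicate {R = SameFace R}
    (λ d d' → any? (λ k → iterate (λ x → Rotation.σ R (θ x)) (toℕ k) d ≟D d')) Ds)

  -- planar: the surface obtained by gluing discs along the facial walks is a
  -- disjoint union of spheres, i.e. Euler's formula V - E + F = 2 holds on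
  -- every component; summed: V - E + F = 2·(#components).
  Planar : Rotation → Set
  Planar R = numVertices + (numFaces R + numIsolated) ≡ 2 * numComponents + numEdges

-- Faces are encoded by their "corners" (occurrences of an
-- edge in a face): corner c belongs to face (face c), traverses edge
-- (edge c) in direction (dir c) (true = from tail to head), and succ c is
-- the next corner of the same face.

record RawComplex : Set where
  field
    nV nE nF nC : ℕ
    tl hd : Fin nE → Fin nV
    face  : Fin nC → Fin nF
    edge  : Fin nC → Fin nE
    dir   : Fin nC → Bool
    succ  : Fin nC → Fin nC

  endOf : Fin nE → Bool → Fin nV
  endOf e true  = hd e
  endOf e false = tl e

  arrive depart : Fin nC → Fin nV
  arrive c = endOf (edge c) (dir c)
  depart c = endOf (edge c) (not (dir c))

record TwoComplex : Set where
  field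
    raw : RawComplex
  open RawComplex raw
  field
    faceCyclic : IsCyclicOn succ face
    faceNonempty : ∀ f → Σ (Fin nC) (λ c → face c ≡ f)
    closed : ∀ c → arrive c ≡ depart (succ c)
    trail : ∀ c c' → face c ≡ face c' → edge c ≡ edge c' → c ≡ c'

module Complex (C : TwoComplex) where
  open TwoComplex C
  open RawComplex raw public

  facesAt : Fin nE → ℕ
  facesAt e = length (filter (λ f → any? (λ c → (face c Fin.≟ f) ×-dec (edge c Fin.≟ e))) (allFin nF))

  -- link graph L(v): vertices = edge-ends at v; edges = traversals of v by faces,
  -- a traversal being a corner c arriving at v (joining c's end with succ c's end)
  LV : Fin nV → Set
  LV v = Σ (Fin nE × Bool) (λ eb → endOf (proj₁ eb) (proj₂ eb) ≡ v)

  LE : Fin nV → Set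
  LE v = Σ (Fin nC) (λ c → arrive c ≡ v)

  private
    irrV : ∀ {x y : Fin nV} (p q : x ≡ y) → p ≡ q
    irrV = Decidable⇒UIP.≡-irrelevant Fin._≟_

  Lend : (v : Fin nV) → LE v → Bool → LV v
  Lend v (c , p) false = (edge c , dir c) , p
  Lend v (c , p) true  = (edge (succ c) , not (dir (succ c))) , trans (sym (closed c)) p

  L : Fin nV → Graph
  L v = record
    { V = LV v
    ; E = LE v
    ; finV = finiteΣ (finite× (finiteFin nE) finiteBool) _ (λ eb → endOf (proj₁ eb) (proj₂ eb) Fin.≟ v) irrV
    ; finE = finiteΣ (finiteFin nC) _ (λ c → arrive c Fin.≟ v) irrV
    ; end = Lend v }

  open GraphTheory using (Dart; vert; Rotation; Planar)

  -- the dart of L(v) at edge-end (e,b) belonging to a link edge corresponds to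
  -- the face (corner of e) it comes from
  κ : {v : Fin nV} → Dart (L v) → Fin nC
  κ ((c , _) , false) = c
  κ ((c , _) , true)  = succ c

  -- rotation system of C: for each edge a cyclic orientation of the faces
  -- at e (= corners of e)
  IsRotationSystem : (Fin nC → Fin nC) → Set
  IsRotationSystem ρ = IsCyclicOn ρ edge

  -- R is the rotation system of L(v) induced by ρ: at (e,true) (e directed
  -- towards v) the rotator is ρ_e, at (e,false) its reverse
  Induced : {v : Fin nV} → (Fin nC → Fin nC) → Rotation (L v) → Set
  Induced {v} ρ R = ∀ (d : Dart (L v)) →
    if proj₂ (proj₁ (vert (L v) d))
    then κ (Rotation.σ R d) ≡ ρ (κ d)
    else ρ (κ (Rotation.σ R d)) ≡ κ d

  PlanarRotationSystem : (Fin nC → Fin nC) → Set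
  PlanarRotationSystem ρ = IsRotationSystem ρ ×
    (∀ v → Σ (Rotation (L v)) (λ R → Induced ρ R × Planar (L v) R))

  module _ (rot : (v : Fin nV) → Rotation (L v)) where
    σh : (e : Fin nE) → Dart (L (hd e)) → Dart (L (hd e))
    σh e = Rotation.σ (rot (hd e))
    σt : (e : Fin nE) → Dart (L (tl e)) → Dart (L (tl e))
    σt e = Rotation.σ (rot (tl e))

    RotatorsEqual : Fin nE → Set
    RotatorsEqual e = ∀ (d : Dart (L (hd e))) (d' : Dart (L (tl e))) →
      proj₁ (vert (L (hd e)) d) ≡ (e , true) → proj₁ (vert (L (tl e)) d') ≡ (e , false) →
      κ d ≡ κ d' → κ (σh e d) ≡ κ (σt e d')

    RotatorsReverse : Fin nE → Set
    RotatorsReverse e = ∀ (d : Dart (L (hd e))) (d' : Dart (L (tl e))) →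
      proj₁ (vert (L (hd e)) d) ≡ (e , true) → proj₁ (vert (L (tl e)) d') ≡ (e , false) →
      κ d' ≡ κ (σh e d) → κ (σt e d') ≡ κ d

    Green Red : Fin nE → Set
    Green e = RotatorsReverse e
    Red e = ¬ Green e

  record RotationFramework : Set where
    field
      rot        : (v : Fin nV) → Rotation (L v)
      planar     : ∀ v → Planar (L v) (rot v)
      compatible : ∀ e → RotatorsEqual rot e ⊎ RotatorsReverse rot e

  record Cycle : Set where
    field
      len   : ℕ
      cedge : Fin (suc len) → Fin nE
      cdir  : Fin (suc len) → Bool
      linked : ∀ i → endOf (cedge i) (cdir i) ≡ endOf (cedge (next i)) (not (cdir (next i)))
      edgesDistinct : ∀ i j → cedge i ≡ cedge j → i ≡ j
      verticesDistinct : ∀ i j → endOf (cedge i) (not (cdir i)) ≡ endOf (cedge j) (not (cdir j)) → i ≡ j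

  countTrue : {n : ℕ} → (Fin n → Bool) → ℕ
  countTrue {n} col = length (filter (λ i → T? (col i)) (allFin n))

  IsEven : RotationFramework → Set
  IsEven Φ = ∀ (Z : Cycle) → let open Cycle Z in
    Σ (Fin (suc len) → Bool) (λ col →
      (∀ i → (col i ≡ true → Red (RotationFramework.rot Φ) (cedge i)) ×
             (Red (RotationFramework.rot Φ) (cedge i) → col i ≡ true)) ×
      Σ ℕ (λ m → countTrue col ≡ 2 * m))

-- A planar rotation system of C induces planar rotations on all links, and at every edge the
-- rotators it induces at the two ends are reverse to each other, so all edges are green and the
-- framework is even.
--
-- Conversely, label the red edges of an even framework by 1. Being even on every cycle, this
-- labelling is a coboundary: there is s : V → 𝔽₂ with red e = s (hd e) + s (tl e). It is built edge
-- by edge, keeping a simple path between any two vertices of a component, so that an edge inside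
-- a component closes a cycle and is forced to be consistent. Reversing the link rotation at every
-- vertex with s = 1 keeps the links planar (reversal runs every face backwards) and turns every edge
-- green. Finally, in an all-green framework the rotators at the heads of the edges form a
-- rotation system of C, which induces the rotators at the tails as well.

{-# OPTIONS --safe #-}
module Submission where

open import Defs
open import Data.Nat using (ℕ; zero; suc; _+_; _*_; _∸_; _≤_; _<_; _≟_; _<?_)
open import Data.Nat.Properties
  using ( +-comm; *-comm; +-suc; suc-injective; ≤-refl; ≤-trans; ≤-antisym; ≤-pred; <⇒≤; <-≤-trans
        ; n≤1+n; m<n⇒m<1+n; <-irrefl; ≤∧≢⇒<; ≮⇒≥; m∸n≤m; m∸n+n≡m; m<n⇒0<n∸m )
open import Data.Nat.DivMod using (_%_; _/_; m≡m%n+[m/n]*n; m%n<n; m<n⇒m%n≡m; n%n≡0)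
open import Data.Bool using (Bool; true; false; not; T; T?; if_then_else_; _xor_)
import Data.Bool as Bool
open import Data.Bool.Properties using (not-involutive; not-¬; ¬-not; xor-comm; xor-same)
open import Data.Fin using (Fin; toℕ; fromℕ<)
import Data.Fin as Fin
open import Data.Fin.Properties using (pigeonhole; toℕ-injective; toℕ-fromℕ<; toℕ<n; any?; injective⇒≤)
open import Data.Product using (Σ; _×_; _,_; proj₁; proj₂)
open import Data.Product.Properties using (≡-dec)
open import Data.Sum using (_⊎_; inj₁; inj₂)
open import Data.Empty using (⊥-elim)
open import Data.List using (List; []; _∷_; _++_; length; lookup; map; foldr; filter; allFin; deduplicate)
open import Data.List.Properties using (map-∘; map-tabulate; tabulate-lookup; filter-≐; filter-none)
open import Data.List.Relation.Unary.Any using (index)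
import Data.List.Relation.Unary.Any as Any
open import Data.List.Relation.Unary.All using (All; []; _∷_)
import Data.List.Relation.Unary.All as All
import Data.List.Relation.Unary.All.Properties as All
open import Data.List.Relation.Unary.AllPairs using (AllPairs; []; _∷_)
import Data.List.Relation.Unary.AllPairs.Properties as AllPairs
open import Data.List.Membership.Propositional using (_∈_)
open import Data.List.Membership.Propositional.Properties using (∈-lookup)
open import Data.List.Membership.Setoid.Properties using (index-injective; ∈-deduplicate⁺)
open import Data.List.Relation.Unary.Unique.DecSetoid.Properties using (deduplicate-!)
open import Relation.Binary using (Rel; Symmetric; Decidable; IsEquivalence; Setoid; DecSetoid)
open import Relation.Binary.PropositionalEquality
open import Relation.Nullary using (¬_; Dec; yes; no; does)
open import Relation.Nullary.Decidable using (_→-dec_)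
open import Function using (_∘_; id)
open import Function.Bundles using (_⇔_; mk⇔)
open import Level using (0ℓ)

-- Iterates and orbits

module _ {A : Set} (f : A → A) where

  iterate-+ : ∀ m n a → iterate f (m + n) a ≡ iterate f m (iterate f n a)
  iterate-+ zero    n a = refl
  iterate-+ (suc m) n a = cong f (iterate-+ m n a)

  iterate-sucʳ : ∀ k a → iterate f (suc k) a ≡ iterate f k (f a)
  iterate-sucʳ k a = trans (cong (λ n → iterate f n a) (+-comm 1 k)) (iterate-+ k 1 a)

  iterate-comm : ∀ m n a → iterate f m (iterate f n a) ≡ iterate f n (iterate f m a)
  iterate-comm m n a = begin
    iterate f m (iterate f n a)  ≡⟨ iterate-+ m n a ⟨
    iterate f (m + n) a          ≡⟨ cong (λ k → iterate f k a) (+-comm m n) ⟩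
    iterate f (n + m) a          ≡⟨ iterate-+ n m a ⟩
    iterate f n (iterate f m a)  ∎
    where open ≡-Reasoning

  iterate-injective : (∀ a b → f a ≡ f b → a ≡ b) → ∀ k a b → iterate f k a ≡ iterate f k b → a ≡ b
  iterate-injective inj zero    a b eq = eq
  iterate-injective inj (suc k) a b eq = iterate-injective inj k a b (inj _ _ eq)

  iterate-*-fixed : ∀ p a → iterate f p a ≡ a → ∀ q → iterate f (q * p) a ≡ a
  iterate-*-fixed p a fixed zero    = refl
  iterate-*-fixed p a fixed (suc q) = begin
    iterate f (p + q * p) a            ≡⟨ iterate-+ p (q * p) a ⟩
    iterate f p (iterate f (q * p) a)  ≡⟨ cong (iterate f p) (iterate-*-fixed p a fixed q) ⟩
    iterate f p a                      ≡⟨ fixed ⟩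
    a                                  ∎
    where open ≡-Reasoning

  iterate-cancel : (g : A → A) (h : A → A) → (∀ x → f (h (g x)) ≡ h x) →
                   ∀ k x → iterate f k (h (iterate g k x)) ≡ h x
  iterate-cancel g h cancel zero    x = refl
  iterate-cancel g h cancel (suc k) x = begin
    iterate f (suc k) (h (g (iterate g k x)))  ≡⟨ iterate-sucʳ k _ ⟩
    iterate f k (f (h (g (iterate g k x))))    ≡⟨ cong (iterate f k) (cancel _) ⟩
    iterate f k (h (iterate g k x))            ≡⟨ iterate-cancel g h cancel k x ⟩
    h x                                        ∎
    where open ≡-Reasoning

module CyclicInverse {A B : Set} {f : A → A} {cls : A → B} (cyc : IsCyclicOn f cls) where
  open IsCyclicOn cyc

  private
    -- f^k (f a) ≡ a, so f^(k-1) (f a) is the preimage of a (and a itself if k = 0)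
    preimage : ∀ a → Σ ℕ (λ k → iterate f k (f a) ≡ a) → A
    preimage a (zero  , _) = a
    preimage a (suc k , _) = iterate f k (f a)

    f-preimage : ∀ a orbit → f (preimage a orbit) ≡ a
    f-preimage a (zero  , fa≡a) = fa≡a
    f-preimage a (suc k , eq)   = eq

  predecessor : A → A
  predecessor a = preimage a (transitive (f a) a (preserves a))

  f∘predecessor : ∀ a → f (predecessor a) ≡ a
  f∘predecessor a = f-preimage a (transitive (f a) a (preserves a))

  predecessor∘f : ∀ a → predecessor (f a) ≡ a
  predecessor∘f a = injective _ _ (f∘predecessor (f a))

  predecessor-cyclic : IsCyclicOn predecessor cls
  predecessor-cyclic = record
    { preserves  = λ a → trans (sym (preserves (predecessor a))) (cong cls (f∘predecessor a))
    ; injective  = λ a a' eq → trans (sym (f∘predecessor a)) (trans (cong f eq) (f∘predecessor a'))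
    ; transitive = λ a a' same → let (k , fᵏa'≡a) = transitive a' a (sym same) in
        k , trans (cong (iterate predecessor k) (sym fᵏa'≡a))
                  (iterate-cancel predecessor f id predecessor∘f k a') }

module Orbits {A : Set} (FA : Finite A) (τ : A → A) (τ-injective : ∀ a b → τ a ≡ τ b → a ≡ b) where
  open Finite FA using (elems; complete)

  SameOrbit : Rel A 0ℓ
  SameOrbit a b = Σ (Fin (length elems)) λ k → iterate τ (toℕ k) a ≡ b

  period : ∀ a → Σ ℕ λ p → 0 < p × p ≤ length elems × iterate τ p a ≡ a
  period a with pigeonhole ≤-refl (λ i → index (complete (iterate τ (toℕ i) a)))
  ... | i , j , i<j , same-index = toℕ j ∸ toℕ i , m<n⇒0<n∸m i<j , p≤N , returns
    where
    p≤N : toℕ j ∸ toℕ i ≤ length elems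
    p≤N = ≤-trans (m∸n≤m (toℕ j) (toℕ i)) (≤-pred (toℕ<n j))
    returns : iterate τ (toℕ j ∸ toℕ i) a ≡ a
    returns = iterate-injective τ τ-injective (toℕ i) _ _ (begin
      iterate τ (toℕ i) (iterate τ (toℕ j ∸ toℕ i) a)  ≡⟨ iterate-comm τ (toℕ i) (toℕ j ∸ toℕ i) a ⟩
      iterate τ (toℕ j ∸ toℕ i) (iterate τ (toℕ i) a)  ≡⟨ iterate-+ τ (toℕ j ∸ toℕ i) (toℕ i) a ⟨
      iterate τ (toℕ j ∸ toℕ i + toℕ i) a              ≡⟨ cong (λ n → iterate τ n a) (m∸n+n≡m (<⇒≤ i<j)) ⟩
      iterate τ (toℕ j) a                               ≡⟨ index-injective (setoid A) (complete _) (complete _) same-index ⟨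
      iterate τ (toℕ i) a                               ∎)
      where open ≡-Reasoning

  -- every exponent can be reduced modulo the period
  sameOrbit : ∀ n {a b} → iterate τ n a ≡ b → SameOrbit a b
  sameOrbit n {a} {b} τⁿa≡b with period a
  ... | p@(suc _) , _ , p≤N , τᵖa≡a = fromℕ< n%p<N , (begin
    iterate τ (toℕ (fromℕ< n%p<N)) a             ≡⟨ cong (λ k → iterate τ k a) (toℕ-fromℕ< n%p<N) ⟩
    iterate τ (n % p) a                          ≡⟨ cong (iterate τ (n % p)) (iterate-*-fixed τ p a τᵖa≡a (n / p)) ⟨
    iterate τ (n % p) (iterate τ (n / p * p) a)  ≡⟨ iterate-+ τ (n % p) (n / p * p) a ⟨
    iterate τ (n % p + n / p * p) a              ≡⟨ cong (λ k → iterate τ k a) (m≡m%n+[m/n]*n n p) ⟨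
    iterate τ n a                                ≡⟨ τⁿa≡b ⟩
    b                                            ∎)
    where
    open ≡-Reasoning
    n%p<N = <-≤-trans (m%n<n n p) p≤N

  sameOrbit-isEquivalence : IsEquivalence SameOrbit
  sameOrbit-isEquivalence = record
    { refl  = sameOrbit 0 refl
    ; sym   = orbit-sym
    ; trans = λ { {a} (i , τⁱa≡b) (j , τʲb≡c) →
        sameOrbit (toℕ j + toℕ i)
          (trans (iterate-+ τ (toℕ j) (toℕ i) a) (trans (cong (iterate τ (toℕ j)) τⁱa≡b) τʲb≡c)) } }
    where
    orbit-sym : Symmetric SameOrbit
    orbit-sym {a} {b} (i , τⁱa≡b) with period a
    ... | p@(suc p-1) , _ , _ , τᵖa≡a = sameOrbit (p-1 * toℕ i) (begin
      iterate τ (p-1 * toℕ i) b                        ≡⟨ cong (iterate τ (p-1 * toℕ i)) τⁱa≡b ⟨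
      iterate τ (p-1 * toℕ i) (iterate τ (toℕ i) a)    ≡⟨ iterate-+ τ (p-1 * toℕ i) (toℕ i) a ⟨
      iterate τ (p-1 * toℕ i + toℕ i) a                ≡⟨ cong (λ k → iterate τ k a) (trans (+-comm (p-1 * toℕ i) (toℕ i)) (*-comm p (toℕ i))) ⟩
      iterate τ (toℕ i * p) a                          ≡⟨ iterate-*-fixed τ p a τᵖa≡a (toℕ i) ⟩
      a                                                ∎)
      where open ≡-Reasoning

AllPairs-lookup-injective : {A : Set} {R : Rel A 0ℓ} → Symmetric R → {xs : List A} →
  AllPairs (λ a b → ¬ R a b) xs → ∀ {i j} → R (lookup xs i) (lookup xs j) → i ≡ j
AllPairs-lookup-injective R-sym (_ ∷ _) {Fin.zero} {Fin.zero} _ = refl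
AllPairs-lookup-injective R-sym (apart ∷ _) {Fin.zero} {Fin.suc j} r = ⊥-elim (All.lookup apart (∈-lookup j) r)
AllPairs-lookup-injective R-sym (apart ∷ _) {Fin.suc i} {Fin.zero} r = ⊥-elim (All.lookup apart (∈-lookup i) (R-sym r))
AllPairs-lookup-injective R-sym (_ ∷ rest) {Fin.suc i} {Fin.suc j} r = cong Fin.suc (AllPairs-lookup-injective R-sym rest r)

module _ {A : Set} {R S : Rel A 0ℓ} (R? : Decidable R) (S? : Decidable S)
         (R-equiv : IsEquivalence R) (S-equiv : IsEquivalence S) where
  private
    R-setoid : Setoid 0ℓ 0ℓ
    R-setoid = record { isEquivalence = R-equiv }
    S-decSetoid : DecSetoid 0ℓ 0ℓ
    S-decSetoid = record { isDecEquivalence = record { isEquivalence = S-equiv ; _≟_ = S? } }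
    module R = IsEquivalence R-equiv

  deduplicate-length-≤ : (f : A → A) → (∀ {a b} → R (f a) (f b) → S a b) →
    ∀ xs → (∀ a → a ∈ xs) → length (deduplicate S? xs) ≤ length (deduplicate R? xs)
  deduplicate-length-≤ f reflects xs complete =
    injective⇒≤ {f = index ∘ classOf ∘ lookup (deduplicate S? xs)} λ same →
      AllPairs-lookup-injective (IsEquivalence.sym S-equiv) (deduplicate-! S-decSetoid xs)
        (reflects (index-injective R-setoid (classOf _) (classOf _) same))
    where
    classOf : ∀ a → Any.Any (R (f a)) (deduplicate R? xs)
    classOf a = ∈-deduplicate⁺ R-setoid R? (λ z~y x~y → R.trans x~y (R.sym z~y))
                  (Any.map (λ { refl → R.refl }) (complete (f a)))

-- Reversing a rotation system

module Reversal (G : Graph) where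
  open Graph G
  open GraphTheory G

  θ-involutive : ∀ d → θ (θ d) ≡ d
  θ-involutive (e , b) = cong (e ,_) (not-involutive b)

  θ-injective : ∀ d d' → θ d ≡ θ d' → d ≡ d'
  θ-injective d d' eq = trans (sym (θ-involutive d)) (trans (cong θ eq) (θ-involutive d'))

  reverse : Rotation → Rotation
  reverse R = record { σ = predecessor ; cyclic = predecessor-cyclic }
    where open CyclicInverse (Rotation.cyclic R)

  module _ (R : Rotation) where
    open Rotation R
    open CyclicInverse cyclic using (f∘predecessor; predecessor∘f)

    private
      faceStep faceStep⁻ : Dart → Dart
      faceStep  d = σ (θ d)
      faceStep⁻ d = Rotation.σ (reverse R) (θ d)

      faceStep-injective : ∀ d d' → faceStep d ≡ faceStep d' → d ≡ d'
      faceStep-injective d d' eq = θ-injective d d' (IsCyclicOn.injective cyclic _ _ eq)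

      faceStep⁻-injective : ∀ d d' → faceStep⁻ d ≡ faceStep⁻ d' → d ≡ d'
      faceStep⁻-injective d d' eq = θ-injective d d' (IsCyclicOn.injective (Rotation.cyclic (reverse R)) _ _ eq)

      sameFace-isEquivalence : IsEquivalence (SameFace R)
      sameFace-isEquivalence = Orbits.sameOrbit-isEquivalence finD faceStep faceStep-injective

      sameFace⁻-isEquivalence : IsEquivalence (SameFace (reverse R))
      sameFace⁻-isEquivalence = Orbits.sameOrbit-isEquivalence finD faceStep⁻ faceStep⁻-injective

      module Face = IsEquivalence sameFace-isEquivalence

    sameFace-reverse : ∀ {a b} → SameFace (reverse R) a b → SameFace R (θ b) (θ a)
    sameFace-reverse {a} {b} (k , eq) = k , (begin
      iterate faceStep (toℕ k) (θ b)                              ≡⟨ cong (λ x → iterate faceStep (toℕ k) (θ x)) eq ⟨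
      iterate faceStep (toℕ k) (θ (iterate faceStep⁻ (toℕ k) a))  ≡⟨ iterate-cancel faceStep faceStep⁻ θ back (toℕ k) a ⟩
      θ a                                                         ∎)
      where
      open ≡-Reasoning
      back : ∀ x → faceStep (θ (faceStep⁻ x)) ≡ θ x
      back x = trans (cong σ (θ-involutive _)) (f∘predecessor (θ x))

    sameFace-unreverse : ∀ {a b} → SameFace R (θ b) (θ a) → SameFace (reverse R) a b
    sameFace-unreverse {a} {b} (k , eq) = k , (begin
      iterate faceStep⁻ (toℕ k) a                                     ≡⟨ cong (iterate faceStep⁻ (toℕ k)) (θ-involutive a) ⟨
      iterate faceStep⁻ (toℕ k) (θ (θ a))                             ≡⟨ cong (λ x → iterate faceStep⁻ (toℕ k) (θ x)) eq ⟨
      iterate faceStep⁻ (toℕ k) (θ (iterate faceStep (toℕ k) (θ b)))  ≡⟨ iterate-cancel faceStep⁻ faceStep θ back (toℕ k) (θ b) ⟩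
      θ (θ b)                                                         ≡⟨ θ-involutive b ⟩
      b                                                               ∎)
      where
      open ≡-Reasoning
      back : ∀ x → faceStep⁻ (θ (faceStep x)) ≡ θ x
      back x = trans (cong (Rotation.σ (reverse R)) (θ-involutive _)) (predecessor∘f (θ x))

    numFaces-reverse : numFaces (reverse R) ≡ numFaces R
    numFaces-reverse = ≤-antisym
      (deduplicate-length-≤ (sameFace? R) (sameFace? (reverse R)) sameFace-isEquivalence sameFace⁻-isEquivalence
         θ (λ same → sameFace-unreverse (Face.sym same)) (Finite.elems finD) (Finite.complete finD))
      (deduplicate-length-≤ (sameFace? (reverse R)) (sameFace? R) sameFace⁻-isEquivalence sameFace-isEquivalence
         θ (λ same → Face.sym (subst₂ (SameFace R) (θ-involutive _) (θ-involutive _) (sameFace-reverse same)))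
         (Finite.elems finD) (Finite.complete finD))
      where
      -- verbatim the decision procedure inside numFaces
      sameFace? : (R : Rotation) → Decidable (SameFace R)
      sameFace? R d d' = any? (λ k → Finite._≟_ finD (iterate (λ x → Rotation.σ R (θ x)) (toℕ k) d) d')

  reverse-planar : ∀ R → Planar R → Planar (reverse R)
  reverse-planar R planar = trans (cong (λ n → numVertices + (n + numIsolated)) (numFaces-reverse R)) planar

odd : ℕ → Bool
odd zero    = false
odd (suc n) = not (odd n)

odd-double : ∀ m → odd (2 * m) ≡ false
odd-double zero    = refl
odd-double (suc m) = begin
  odd (suc (m + suc (m + 0)))    ≡⟨ cong (odd ∘ suc) (+-suc m (m + 0)) ⟩
  not (not (odd (m + (m + 0))))  ≡⟨ not-involutive _ ⟩
  odd (2 * m)                    ≡⟨ odd-double m ⟩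
  false                          ∎
  where open ≡-Reasoning

xorSum : List Bool → Bool
xorSum = foldr _xor_ false

xorSum-odd : {A : Set} (g : A → Bool) (xs : List A) → xorSum (map g xs) ≡ odd (length (filter (T? ∘ g) xs))
xorSum-odd g []       = refl
xorSum-odd g (x ∷ xs) with g x
... | true  = cong not (xorSum-odd g xs)
... | false = xorSum-odd g xs

xor≡false⇒≡ : ∀ p q → p xor q ≡ false → p ≡ q
xor≡false⇒≡ true  true  _ = refl
xor≡false⇒≡ false false _ = refl

xor-telescope : ∀ p q r → (p xor q) xor (q xor r) ≡ p xor r
xor-telescope true  true  r     = refl
xor-telescope true  false r     = refl
xor-telescope false false r     = refl
xor-telescope false true  true  = refl
xor-telescope false true  false = refl

xor-shift : ∀ p q r → p xor q ≡ (p xor r) xor (q xor r)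
xor-shift p q r = sym (trans (cong ((p xor r) xor_) (xor-comm q r)) (xor-telescope p r q))

xor-rebalance : ∀ l p q → (p xor (l xor (p xor q))) xor q ≡ l
xor-rebalance true  true  true  = refl
xor-rebalance true  true  false = refl
xor-rebalance true  false true  = refl
xor-rebalance true  false false = refl
xor-rebalance false true  true  = refl
xor-rebalance false true  false = refl
xor-rebalance false false true  = refl
xor-rebalance false false false = refl

lookup-allFin : {A : Set} (xs : List A) → map (lookup xs) (allFin (length xs)) ≡ xs
lookup-allFin xs = trans (map-tabulate id (lookup xs)) (tabulate-lookup xs)

next-cases : ∀ {n} (i : Fin (suc n)) → toℕ (next i) ≡ suc (toℕ i) ⊎ (suc (toℕ i) ≡ suc n × next i ≡ Fin.zero)
next-cases {n} i with suc (toℕ i) <? suc n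
... | yes i<n = inj₁ (trans (toℕ-fromℕ< (m%n<n (suc (toℕ i)) (suc n))) (m<n⇒m%n≡m i<n))
... | no  i≮n = let last = ≤-antisym (toℕ<n i) (≮⇒≥ i≮n) in
  inj₂ (last , toℕ-injective (trans (toℕ-fromℕ< (m%n<n (suc (toℕ i)) (suc n))) (trans (cong (_% suc n) last) (n%n≡0 (suc n)))))

-- Link graphs and rotators

Finite-∀? : {A : Set} {P : A → Set} → Finite A → (∀ a → Dec (P a)) → Dec (∀ a → P a)
Finite-∀? FA P? with All.all? P? (Finite.elems FA)
... | yes all = yes λ a → All.lookup all (Finite.complete FA a)
... | no ¬all = no λ ∀P → ¬all (All.tabulate λ {a} _ → ∀P a)

module Links (C : TwoComplex) where
  open TwoComplex C using (faceCyclic; closed)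
  open Complex C
  open GraphTheory using (Dart; vert; Rotation; finD)
  open Reversal using (reverse)
  open CyclicInverse faceCyclic using (predecessor; f∘predecessor)

  edgeEnd : ∀ {v} → Dart (L v) → Fin nE × Bool
  edgeEnd {v} d = proj₁ (vert (L v) d)

  κ-edge : ∀ {v} (d : Dart (L v)) → edge (κ d) ≡ proj₁ (edgeEnd d)
  κ-edge (_ , false) = refl
  κ-edge (_ , true)  = refl

  κ-injective : ∀ {v} (d d' : Dart (L v)) → edgeEnd d ≡ edgeEnd d' → κ d ≡ κ d' → d ≡ d'
  κ-injective ((c , p) , false) ((c' , p') , false) _ refl with p | p'
  ... | refl | refl = refl
  κ-injective ((c , p) , true) ((c' , p') , true) _ succ-c≡succ-c'
    with IsCyclicOn.injective faceCyclic c c' succ-c≡succ-c'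
  ... | refl with p | p'
  ... | refl | refl = refl
  κ-injective ((c , p) , false) ((c' , p') , true) same-end refl = ⊥-elim (not-¬ refl (cong proj₂ same-end))
  κ-injective ((c , p) , true) ((c' , p') , false) same-end refl = ⊥-elim (not-¬ refl (sym (cong proj₂ same-end)))

  vert-edgeEnd : ∀ {v} (d d' : Dart (L v)) → edgeEnd d ≡ edgeEnd d' → vert (L v) d ≡ vert (L v) d'
  vert-edgeEnd {v} d d' same with vert (L v) d | vert (L v) d'
  ... | (x , p) | (y , q) with same
  ... | refl with p | q
  ... | refl | refl = refl

  edgeEnd-σ : ∀ {v} (R : Rotation (L v)) d → edgeEnd (Rotation.σ R d) ≡ edgeEnd d
  edgeEnd-σ R d = cong proj₁ (IsCyclicOn.preserves (Rotation.cyclic R) d)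

  -- At an end (e , b) of e at v, the link darts correspond to the corners of e:
  -- a corner c arrives at v along e, or its predecessor in the face does.
  dartWithCorner : ∀ v e b → endOf e b ≡ v → ∀ c → edge c ≡ e →
    Σ (Dart (L v)) λ d → edgeEnd d ≡ (e , b) × κ d ≡ c
  dartWithCorner v e b at-v c c∈e with dir c Bool.≟ b
  ... | yes c-arrives = ((c , trans (cong₂ endOf c∈e c-arrives) at-v) , false) , cong₂ _,_ c∈e c-arrives , refl
  ... | no c-departs =
    ((predecessor c , arrives) , true) ,
    cong₂ _,_ (trans (cong edge succ-pred) c∈e) (trans (cong (not ∘ dir) succ-pred) leaves) ,
    succ-pred
    where
    succ-pred = f∘predecessor c
    leaves : not (dir c) ≡ b
    leaves = sym (¬-not (c-departs ∘ sym))
    arrives : arrive (predecessor c) ≡ v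
    arrives = begin
      arrive (predecessor c)         ≡⟨ closed (predecessor c) ⟩
      depart (succ (predecessor c))  ≡⟨ cong depart succ-pred ⟩
      depart c                       ≡⟨ cong₂ endOf c∈e leaves ⟩
      endOf e b                      ≡⟨ at-v ⟩
      v                              ∎
      where open ≡-Reasoning

  module _ {v} (R : Rotation (L v)) where
    open Rotation R

    κ-σ-injective : ∀ d d' → edgeEnd d ≡ edgeEnd d' → κ (σ d) ≡ κ (σ d') → d ≡ d'
    κ-σ-injective d d' same-end same-κ = IsCyclicOn.injective cyclic d d'
      (κ-injective (σ d) (σ d') (trans (edgeEnd-σ R d) (trans same-end (sym (edgeEnd-σ R d')))) same-κ)

    κ-reverse : ∀ d z → edgeEnd d ≡ edgeEnd z → κ d ≡ κ (σ z) → κ (Rotation.σ (reverse (L v) R) d) ≡ κ z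
    κ-reverse d z same-end same-κ = cong κ (begin
      Rotation.σ (reverse (L v) R) d      ≡⟨ cong (Rotation.σ (reverse (L v) R)) d≡σz ⟩
      Rotation.σ (reverse (L v) R) (σ z)  ≡⟨ predecessor∘f z ⟩
      z                                   ∎)
      where
      open ≡-Reasoning
      open CyclicInverse cyclic using (predecessor∘f)
      d≡σz = κ-injective d (σ z) (trans same-end (sym (edgeEnd-σ R z))) same-κ

  -- RotatorsEqual and RotatorsReverse, for an arbitrary pair of rotations at the ends of e
  module _ (e : Fin nE) (Rₕ : Rotation (L (hd e))) (Rₜ : Rotation (L (tl e))) where
    private
      σₕ = Rotation.σ Rₕ
      σₜ = Rotation.σ Rₜ

    EqualRotators ReverseRotators : Set
    EqualRotators = ∀ (d : Dart (L (hd e))) (d' : Dart (L (tl e))) →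
      edgeEnd d ≡ (e , true) → edgeEnd d' ≡ (e , false) → κ d ≡ κ d' → κ (σₕ d) ≡ κ (σₜ d')
    ReverseRotators = ∀ (d : Dart (L (hd e))) (d' : Dart (L (tl e))) →
      edgeEnd d ≡ (e , true) → edgeEnd d' ≡ (e , false) → κ d' ≡ κ (σₕ d) → κ (σₜ d') ≡ κ d

    reverseRotators? : Dec ReverseRotators
    reverseRotators? = Finite-∀? (finD (L (hd e))) λ d → Finite-∀? (finD (L (tl e))) λ d' →
      (≡-dec Fin._≟_ Bool._≟_ (edgeEnd d) (e , true)) →-dec (≡-dec Fin._≟_ Bool._≟_ (edgeEnd d') (e , false)) →-dec
      (κ d' Fin.≟ κ (σₕ d)) →-dec (κ (σₜ d') Fin.≟ κ d)

  module _ {e : Fin nE} (Rₕ : Rotation (L (hd e))) (Rₜ : Rotation (L (tl e))) where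
    private
      σₕ⁻ = Rotation.σ (reverse _ Rₕ)
      σₕ-σₕ⁻ = CyclicInverse.f∘predecessor (Rotation.cyclic Rₕ)

      tailDart : ∀ (d : Dart (L (hd e))) → edgeEnd d ≡ (e , true) →
                 Σ (Dart (L (tl e))) λ z → edgeEnd z ≡ (e , false) × κ z ≡ κ d
      tailDart d at-head = dartWithCorner (tl e) e false refl (κ d) (trans (κ-edge d) (cong proj₁ at-head))

    equal-reverseˡ : EqualRotators e Rₕ Rₜ → ReverseRotators e (reverse _ Rₕ) Rₜ
    equal-reverseˡ equal d d' at-head at-tail same-κ =
      trans (sym (equal (σₕ⁻ d) d' (trans (edgeEnd-σ (reverse _ Rₕ) d) at-head) at-tail (sym same-κ)))
            (cong κ (σₕ-σₕ⁻ d))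

    equal-reverseʳ : EqualRotators e Rₕ Rₜ → ReverseRotators e Rₕ (reverse _ Rₜ)
    equal-reverseʳ equal d d' at-head at-tail same-κ =
      let (z , z-at-tail , κz≡κd) = tailDart d at-head
      in trans (κ-reverse Rₜ d' z (trans at-tail (sym z-at-tail))
                  (trans same-κ (equal d z at-head z-at-tail (sym κz≡κd))))
               κz≡κd

    reverse-reverse : ReverseRotators e Rₕ Rₜ → ReverseRotators e (reverse _ Rₕ) (reverse _ Rₜ)
    reverse-reverse reversed d d' at-head at-tail same-κ =
      let x-at-head = trans (edgeEnd-σ (reverse _ Rₕ) d) at-head
          (z , z-at-tail , κz≡κd) = tailDart d at-head
          κσz≡κx = reversed (σₕ⁻ d) z x-at-head z-at-tail (trans κz≡κd (cong κ (sym (σₕ-σₕ⁻ d))))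
      in trans (κ-reverse Rₜ d' z (trans at-tail (sym z-at-tail)) (trans same-κ (sym κσz≡κx))) κz≡κd

  module _ (ρ : Fin nC → Fin nC) {v} (R : Rotation (L v)) where
    private σ = Rotation.σ R

    induced-head : Induced ρ R → ∀ d {e} → edgeEnd d ≡ (e , true) → κ (σ d) ≡ ρ (κ d)
    induced-head ρ-induces d at-head =
      subst (λ b → if b then κ (σ d) ≡ ρ (κ d) else ρ (κ (σ d)) ≡ κ d) (cong proj₂ at-head) (ρ-induces d)

    induced-tail : Induced ρ R → ∀ d {e} → edgeEnd d ≡ (e , false) → ρ (κ (σ d)) ≡ κ d
    induced-tail ρ-induces d at-tail =
      subst (λ b → if b then κ (σ d) ≡ ρ (κ d) else ρ (κ (σ d)) ≡ κ d) (cong proj₂ at-tail) (ρ-induces d)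

    mkInduced : (∀ d e → edgeEnd d ≡ (e , true) → κ (σ d) ≡ ρ (κ d)) →
              (∀ d e → edgeEnd d ≡ (e , false) → ρ (κ (σ d)) ≡ κ d) → Induced ρ R
    mkInduced at-head at-tail d with edgeEnd d in end
    ... | e , true  = at-head d e end
    ... | e , false = at-tail d e end

  inducedFramework : (ρ : Fin nC → Fin nC) → PlanarRotationSystem ρ → Σ RotationFramework λ Φ →
                     ∀ e → RotatorsReverse (RotationFramework.rot Φ) e
  inducedFramework ρ (ρ-rotation , at) = framework , green
    where
    rot : ∀ v → Rotation (L v)
    rot v = proj₁ (at v)
    green : ∀ e → RotatorsReverse rot e
    green e d d' at-head at-tail same-κ = IsCyclicOn.injective ρ-rotation _ _ (begin
      ρ (κ (Rotation.σ (rot (tl e)) d'))  ≡⟨ induced-tail ρ (rot (tl e)) (proj₁ (proj₂ (at (tl e)))) d' at-tail ⟩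
      κ d'                                ≡⟨ same-κ ⟩
      κ (Rotation.σ (rot (hd e)) d)       ≡⟨ induced-head ρ (rot (hd e)) (proj₁ (proj₂ (at (hd e)))) d at-head ⟩
      ρ (κ d)                             ∎)
      where open ≡-Reasoning
    framework : RotationFramework
    framework = record { rot = rot ; planar = λ v → proj₂ (proj₂ (at v)) ; compatible = inj₂ ∘ green }

  module AllGreen (rot : ∀ v → Rotation (L v)) (green : ∀ e → RotatorsReverse rot e) where
    private
      σ : ∀ v → Dart (L v) → Dart (L v)
      σ v = Rotation.σ (rot v)

      headDart : ∀ e c → edge c ≡ e → Σ (Dart (L (hd e))) λ d → edgeEnd d ≡ (e , true) × κ d ≡ c
      headDart e = dartWithCorner (hd e) e true refl

      headRotator : ∀ e c → edge c ≡ e → Fin nC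
      headRotator e c c∈e = κ (σ (hd e) (proj₁ (headDart e c c∈e)))

      κ-at-head : ∀ e (x : Dart (L (hd e))) → edgeEnd x ≡ (e , true) → edge (κ x) ≡ e
      κ-at-head e x at-head = trans (κ-edge x) (cong proj₁ at-head)

    -- the rotator of each edge as seen from its head; greenness makes the tails see its reverse
    ρ : Fin nC → Fin nC
    ρ c = headRotator (edge c) c refl

    private
      ρ-headRotator : ∀ c e (c∈e : edge c ≡ e) → ρ c ≡ headRotator e c c∈e
      ρ-headRotator c .(edge c) refl = refl

    ρ-κ : ∀ e (x : Dart (L (hd e))) → edgeEnd x ≡ (e , true) → ρ (κ x) ≡ κ (σ (hd e) x)
    ρ-κ e x at-head =
      let κx∈e = κ-at-head e x at-head
          (y , y-at-head , κy≡κx) = headDart e (κ x) κx∈e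
      in trans (ρ-headRotator (κ x) e κx∈e)
               (cong (κ ∘ σ (hd e)) (κ-injective y x (trans y-at-head (sym at-head)) κy≡κx))

    ρ-iterate : ∀ e k (x : Dart (L (hd e))) → edgeEnd x ≡ (e , true) →
                iterate ρ k (κ x) ≡ κ (iterate (σ (hd e)) k x)
    ρ-iterate e zero    x at-head = refl
    ρ-iterate e (suc k) x at-head = begin
      iterate ρ (suc k) (κ x)                ≡⟨ iterate-sucʳ ρ k (κ x) ⟩
      iterate ρ k (ρ (κ x))                  ≡⟨ cong (iterate ρ k) (ρ-κ e x at-head) ⟩
      iterate ρ k (κ (σ (hd e) x))           ≡⟨ ρ-iterate e k (σ (hd e) x) (trans (edgeEnd-σ (rot (hd e)) x) at-head) ⟩
      κ (iterate (σ (hd e)) k (σ (hd e) x))  ≡⟨ cong κ (iterate-sucʳ (σ (hd e)) k x) ⟨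
      κ (iterate (σ (hd e)) (suc k) x)       ∎
      where open ≡-Reasoning

    ρ-rotationSystem : IsRotationSystem ρ
    ρ-rotationSystem = record { preserves = preserves ; injective = injective ; transitive = transitive }
      where
      open ≡-Reasoning

      preserves : ∀ c → edge (ρ c) ≡ edge c
      preserves c = let (x , at-head , _) = headDart (edge c) c refl
                    in κ-at-head (edge c) (σ _ x) (trans (edgeEnd-σ (rot _) x) at-head)

      injective : ∀ c c' → ρ c ≡ ρ c' → c ≡ c'
      injective c c' ρc≡ρc' =
        let e = edge c
            c'∈e = trans (sym (preserves c')) (trans (cong edge (sym ρc≡ρc')) (preserves c))
            (x  , x-at-head  , κx≡c)  = headDart e c refl
            (x' , x'-at-head , κx'≡c') = headDart e c' c'∈e
            κσx≡κσx' = begin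
              κ (σ (hd e) x)   ≡⟨ ρ-κ e x x-at-head ⟨
              ρ (κ x)          ≡⟨ cong ρ κx≡c ⟩
              ρ c              ≡⟨ ρc≡ρc' ⟩
              ρ c'             ≡⟨ cong ρ κx'≡c' ⟨
              ρ (κ x')         ≡⟨ ρ-κ e x' x'-at-head ⟩
              κ (σ (hd e) x')  ∎
            x≡x' = κ-σ-injective (rot (hd e)) x x' (trans x-at-head (sym x'-at-head)) κσx≡κσx'
        in trans (sym κx≡c) (trans (cong κ x≡x') κx'≡c')

      transitive : ∀ c c' → edge c ≡ edge c' → Σ ℕ λ k → iterate ρ k c ≡ c'
      transitive c c' same-edge =
        let e = edge c
            (x  , x-at-head  , κx≡c)  = headDart e c refl
            (x' , x'-at-head , κx'≡c') = headDart e c' (sym same-edge)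
            (k , σᵏx≡x') = IsCyclicOn.transitive (Rotation.cyclic (rot (hd e))) x x'
                             (vert-edgeEnd x x' (trans x-at-head (sym x'-at-head)))
        in k , trans (cong (iterate ρ k) (sym κx≡c)) (trans (ρ-iterate e k x x-at-head) (trans (cong κ σᵏx≡x') κx'≡c'))

    private
      ρ-induced-head : ∀ e v → hd e ≡ v → ∀ (d : Dart (L v)) → edgeEnd d ≡ (e , true) → κ (σ v d) ≡ ρ (κ d)
      ρ-induced-head e .(hd e) refl d at-head = sym (ρ-κ e d at-head)

      ρ-induced-tail : ∀ e v → tl e ≡ v → ∀ (d : Dart (L v)) → edgeEnd d ≡ (e , false) → ρ (κ (σ v d)) ≡ κ d
      ρ-induced-tail e .(tl e) refl d at-tail =
        let w = σ (tl e) d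
            w-at-tail = trans (edgeEnd-σ (rot (tl e)) d) at-tail
            (x , x-at-head , κx≡κw) = headDart e (κ w) (trans (κ-edge w) (cong proj₁ w-at-tail))
            σx-at-head = trans (edgeEnd-σ (rot (hd e)) x) x-at-head
            (z , z-at-tail , κz≡κσx) = dartWithCorner (tl e) e false refl (κ (σ (hd e) x)) (κ-at-head e (σ (hd e) x) σx-at-head)
            z≡d = κ-σ-injective (rot (tl e)) z d (trans z-at-tail (sym at-tail))
                    (trans (green e x z x-at-head z-at-tail κz≡κσx) κx≡κw)
        in begin
          ρ (κ w)             ≡⟨ cong ρ κx≡κw ⟨
          ρ (κ x)             ≡⟨ ρ-κ e x x-at-head ⟩
          κ (σ (hd e) x)      ≡⟨ κz≡κσx ⟨
          κ z                 ≡⟨ cong κ z≡d ⟩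
          κ d                 ∎
        where open ≡-Reasoning

      endpoint : ∀ {v} (d : Dart (L v)) {e b} → edgeEnd d ≡ (e , b) → endOf e b ≡ v
      endpoint {v} d end = subst (λ eb → endOf (proj₁ eb) (proj₂ eb) ≡ v) end (proj₂ (vert (L v) d))

    ρ-induced : ∀ v → Induced ρ (rot v)
    ρ-induced v = mkInduced ρ (rot v)
      (λ d e at-head → ρ-induced-head e v (endpoint d at-head) d at-head)
      (λ d e at-tail → ρ-induced-tail e v (endpoint d at-tail) d at-tail)

-- Labellings that are even on cycles are coboundaries

module Switching (C : TwoComplex) where
  open Complex C

  Arc : Set
  Arc = Fin nE × Bool

  source target : Arc → Fin nV
  source a = endOf (proj₁ a) (not (proj₂ a))
  target a = endOf (proj₁ a) (proj₂ a)

  Walk : Fin nV → List Arc → Fin nV → Set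
  Walk x []       y = x ≡ y
  Walk x (a ∷ as) y = source a ≡ x × Walk (target a) as y

  walk-++ : ∀ {x y z} as {bs} → Walk x as y → Walk y bs z → Walk x (as ++ bs) z
  walk-++ []       refl       w′ = w′
  walk-++ (a ∷ as) (src , w) w′ = src , walk-++ as w w′

  walk-step : ∀ {x y} as → Walk x as y → ∀ i j → toℕ j ≡ suc (toℕ i) → target (lookup as i) ≡ source (lookup as j)
  walk-step (a ∷ b ∷ as) (_ , src , _) Fin.zero (Fin.suc Fin.zero) _ = sym src
  walk-step (a ∷ as) (_ , w) (Fin.suc i) (Fin.suc j) j≡1+i = walk-step as w i j (suc-injective j≡1+i)
  walk-step (a ∷ b ∷ as) _ Fin.zero (Fin.suc (Fin.suc j)) ()
  walk-step (a ∷ as) _ _ Fin.zero ()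

  walk-last : ∀ {x y} as → Walk x as y → ∀ i → suc (toℕ i) ≡ length as → target (lookup as i) ≡ y
  walk-last (a ∷ [])     (_ , w) Fin.zero    _        = w
  walk-last (a ∷ b ∷ as) _       Fin.zero    ()
  walk-last (a ∷ as)     (_ , w) (Fin.suc i) i≡last   = walk-last as w i (suc-injective i≡last)

  DistinctEdges DistinctSources : List Arc → Set
  DistinctEdges   = AllPairs (λ a b → ¬ proj₁ a ≡ proj₁ b)
  DistinctSources = AllPairs (λ a b → ¬ source a ≡ source b)

  closedWalk-cycle : ∀ a as → Walk (source a) (a ∷ as) (source a) →
                     DistinctEdges (a ∷ as) → DistinctSources (a ∷ as) → Cycle
  closedWalk-cycle a as walk distinct-edges distinct-sources = record
    { len              = length as
    ; cedge            = proj₁ ∘ lookup (a ∷ as)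
    ; cdir             = proj₂ ∘ lookup (a ∷ as)
    ; linked           = linked
    ; edgesDistinct    = λ i j → AllPairs-lookup-injective sym distinct-edges
    ; verticesDistinct = λ i j → AllPairs-lookup-injective sym distinct-sources }
    where
    linked : ∀ i → target (lookup (a ∷ as) i) ≡ source (lookup (a ∷ as) (next i))
    linked i with next-cases i
    ... | inj₁ next≡1+i          = walk-step (a ∷ as) walk i (next i) next≡1+i
    ... | inj₂ (i-last , next≡0) = trans (walk-last (a ∷ as) walk i i-last) (cong (source ∘ lookup (a ∷ as)) (sym next≡0))

  EvenOnCycles : (Fin nE → Bool) → Set
  EvenOnCycles lab = ∀ (Z : Cycle) → Σ ℕ λ m → countTrue (λ i → lab (Cycle.cedge Z i)) ≡ 2 * m

  module _ (lab : Fin nE → Bool) (even : EvenOnCycles lab) where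

    labelSum : List Arc → Bool
    labelSum as = xorSum (map (lab ∘ proj₁) as)

    closedWalk-labelSum : ∀ a as → Walk (source a) (a ∷ as) (source a) →
                          DistinctEdges (a ∷ as) → DistinctSources (a ∷ as) → labelSum (a ∷ as) ≡ false
    closedWalk-labelSum a as walk distinct-edges distinct-sources = begin
      xorSum (map (lab ∘ proj₁) (a ∷ as))                              ≡⟨ cong (xorSum ∘ map (lab ∘ proj₁)) (lookup-allFin (a ∷ as)) ⟨
      xorSum (map (lab ∘ proj₁) (map (lookup (a ∷ as)) (allFin _)))     ≡⟨ cong xorSum (map-∘ {g = lab ∘ proj₁} {f = lookup (a ∷ as)} (allFin _)) ⟨
      xorSum (map (lab ∘ proj₁ ∘ lookup (a ∷ as)) (allFin _))           ≡⟨ xorSum-odd (lab ∘ proj₁ ∘ lookup (a ∷ as)) (allFin _) ⟩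
      odd (countTrue (λ i → lab (Cycle.cedge Z i)))                    ≡⟨ cong odd (proj₂ (even Z)) ⟩
      odd (2 * proj₁ (even Z))                                         ≡⟨ odd-double (proj₁ (even Z)) ⟩
      false                                                            ∎
      where
      open ≡-Reasoning
      Z = closedWalk-cycle a as walk distinct-edges distinct-sources

    Early : ℕ → Arc → Set
    Early k a = toℕ (proj₁ a) < k

    record SimplePath (k : ℕ) (x y : Fin nV) : Set where
      field
        arcs            : List Arc
        walk            : Walk x arcs y
        distinctEdges   : DistinctEdges arcs
        distinctSources : DistinctSources arcs
        sourcesAvoidEnd : All (λ a → ¬ source a ≡ y) arcs
        early           : All (Early k) arcs

    emptyPath : ∀ {k} x → SimplePath k x x
    emptyPath x = record { arcs = [] ; walk = refl ; distinctEdges = [] ; distinctSources = [] ; sourcesAvoidEnd = [] ; early = [] }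

    raise : ∀ {k x y} → SimplePath k x y → SimplePath (suc k) x y
    raise P = record { SimplePath P ; early = All.map m<n⇒m<1+n (SimplePath.early P) }

    -- The state after processing the edges numbered below k: component picks a representative
    -- of each connected component of the subgraph they span, and potential realises lab there.
    record PartialSwitching (k : ℕ) : Set where
      field
        component  : Fin nV → Fin nV
        potential  : Fin nV → Bool
        consistent : ∀ f → toℕ f < k → component (hd f) ≡ component (tl f) × lab f ≡ potential (hd f) xor potential (tl f)
        connected  : ∀ x y → component x ≡ component y → SimplePath k x y

    empty : PartialSwitching 0
    empty = record
      { component  = id
      ; potential  = λ _ → false
      ; consistent = λ f ()
      ; connected  = λ { x .x refl → emptyPath x } }

    module _ {k} (S : PartialSwitching k) where
      open PartialSwitching S

      component-arc : ∀ a → Early k a → component (source a) ≡ component (target a)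
      component-arc (f , true)  f<k = sym (proj₁ (consistent f f<k))
      component-arc (f , false) f<k = proj₁ (consistent f f<k)

      component-head : ∀ a → Early k a → component (hd (proj₁ a)) ≡ component (source a)
      component-head (f , true)  f<k = proj₁ (consistent f f<k)
      component-head (f , false) f<k = refl

      label-arc : ∀ a → Early k a → lab (proj₁ a) ≡ potential (source a) xor potential (target a)
      label-arc (f , true)  f<k = trans (proj₂ (consistent f f<k)) (xor-comm (potential (hd f)) _)
      label-arc (f , false) f<k = proj₂ (consistent f f<k)

      walk-component : ∀ {x y} as → Walk x as y → All (Early k) as →
        All (λ a → component (source a) ≡ component x) as × component y ≡ component x
      walk-component []       refl        []             = [] , refl
      walk-component (a ∷ as) (refl , w) (a<k ∷ as<k) =
        let (sources , end) = walk-component as w as<k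
            target≡x = sym (component-arc a a<k)
        in refl ∷ All.map (λ s → trans s target≡x) sources , trans end target≡x

      walk-labelSum : ∀ {x y} as → Walk x as y → All (Early k) as → labelSum as ≡ potential x xor potential y
      walk-labelSum []       refl        []             = sym (xor-same (potential _))
      walk-labelSum {y = y} (a ∷ as) (refl , w) (a<k ∷ as<k) =
        trans (cong₂ _xor_ (label-arc a a<k) (walk-labelSum as w as<k))
              (xor-telescope (potential (source a)) (potential (target a)) (potential y))

    module Extend {k} (S : PartialSwitching k) (e : Fin nE) (e≡k : toℕ e ≡ k) where
      open PartialSwitching S

      private
        old-or-new : ∀ f → toℕ f < suc k → toℕ f < k ⊎ f ≡ e
        old-or-new f f<1+k with toℕ f ≟ toℕ e
        ... | yes same   = inj₂ (toℕ-injective same)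
        ... | no  differ = inj₁ (≤∧≢⇒< (≤-pred f<1+k) (λ f≡k → differ (trans f≡k (sym e≡k))))

        old≢new : ∀ a → Early k a → ¬ proj₁ a ≡ e
        old≢new a a<k a≡e = <-irrefl (trans (cong toℕ a≡e) e≡k) a<k

      close : component (tl e) ≡ component (hd e) → PartialSwitching (suc k)
      close same = record
        { component  = component
        ; potential  = potential
        ; consistent = consistent′
        ; connected  = λ x y c → raise (connected x y c) }
        where
        open SimplePath (connected (hd e) (tl e) (sym same))

        lab-e : lab e ≡ potential (hd e) xor potential (tl e)
        lab-e = xor≡false⇒≡ _ _ (begin
          lab e xor (potential (hd e) xor potential (tl e))  ≡⟨ cong (lab e xor_) (walk-labelSum S arcs walk early) ⟨
          labelSum ((e , true) ∷ arcs)                        ≡⟨ closedWalk-labelSum (e , true) arcs (refl , walk) edges sources ⟩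
          false                                               ∎)
          where
          open ≡-Reasoning
          edges : DistinctEdges ((e , true) ∷ arcs)
          edges = All.map (λ {a} a<k e≡a → old≢new a a<k (sym e≡a)) early ∷ distinctEdges
          sources : DistinctSources ((e , true) ∷ arcs)
          sources = All.map (λ avoids tl≡source → avoids (sym tl≡source)) sourcesAvoidEnd ∷ distinctSources

        consistent′ : ∀ f → toℕ f < suc k → component (hd f) ≡ component (tl f) × lab f ≡ potential (hd f) xor potential (tl f)
        consistent′ f f<1+k with old-or-new f f<1+k
        ... | inj₁ f<k  = consistent f f<k
        ... | inj₂ refl = sym same , lab-e

      module Join (separate : ¬ component (tl e) ≡ component (hd e)) where
        private
          InHead : Fin nV → Set
          InHead v = component v ≡ component (hd e)

          -- shifting the head side by δ makes e consistent
          δ : Bool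
          δ = lab e xor (potential (hd e) xor potential (tl e))

        component′ : Fin nV → Fin nV
        component′ v with component v Fin.≟ component (hd e)
        ... | yes _ = component (tl e)
        ... | no  _ = component v

        potential′ : Fin nV → Bool
        potential′ v with component v Fin.≟ component (hd e)
        ... | yes _ = potential v xor δ
        ... | no  _ = potential v

        private
          moved : ∀ v → InHead v → component′ v ≡ component (tl e) × potential′ v ≡ potential v xor δ
          moved v in-head with component v Fin.≟ component (hd e)
          ... | yes _      = refl , refl
          ... | no  not-in = ⊥-elim (not-in in-head)

          kept : ∀ v → ¬ InHead v → component′ v ≡ component v × potential′ v ≡ potential v
          kept v not-in with component v Fin.≟ component (hd e)
          ... | yes in-head = ⊥-elim (not-in in-head)
          ... | no  _       = refl , refl

        consistent′ : ∀ f → toℕ f < suc k →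
          component′ (hd f) ≡ component′ (tl f) × lab f ≡ potential′ (hd f) xor potential′ (tl f)
        consistent′ f f<1+k with old-or-new f f<1+k
        ... | inj₂ refl =
          let (comp-hd , pot-hd) = moved (hd e) refl
              (comp-tl , pot-tl) = kept (tl e) separate
          in trans comp-hd (sym comp-tl) ,
             sym (trans (cong₂ _xor_ pot-hd pot-tl) (xor-rebalance (lab e) (potential (hd e)) (potential (tl e))))
        ... | inj₁ f<k = old-edge f (consistent f f<k) (component (hd f) Fin.≟ component (hd e))
          where
          old-edge : ∀ f → component (hd f) ≡ component (tl f) × lab f ≡ potential (hd f) xor potential (tl f) →
            Dec (InHead (hd f)) → component′ (hd f) ≡ component′ (tl f) × lab f ≡ potential′ (hd f) xor potential′ (tl f)
          old-edge f (same , lab-f) (yes hd-in) =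
            let (comp-hd , pot-hd) = moved (hd f) hd-in
                (comp-tl , pot-tl) = moved (tl f) (trans (sym same) hd-in)
            in trans comp-hd (sym comp-tl) ,
               trans lab-f (trans (xor-shift (potential (hd f)) (potential (tl f)) δ) (sym (cong₂ _xor_ pot-hd pot-tl)))
          old-edge f (same , lab-f) (no hd-out) =
            let (comp-hd , pot-hd) = kept (hd f) hd-out
                (comp-tl , pot-tl) = kept (tl f) (hd-out ∘ trans same)
            in trans comp-hd (trans same (sym comp-tl)) , trans lab-f (sym (cong₂ _xor_ pot-hd pot-tl))

        private
          -- The paths on the two sides of the new edge d lie in different components, so they cannot meet.
          join : ∀ {x y} d → proj₁ d ≡ e → ¬ component (source d) ≡ component (target d) →
                 SimplePath k x (source d) → SimplePath k (target d) y → SimplePath (suc k) x y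
          join {x} {y} d d-new split P₁ P₂ = record
            { arcs            = P₁.arcs ++ d ∷ P₂.arcs
            ; walk            = walk-++ P₁.arcs P₁.walk (refl , P₂.walk)
            ; distinctEdges   = AllPairs.++⁺ P₁.distinctEdges (d-edge-fresh ∷ P₂.distinctEdges) edges-across
            ; distinctSources = AllPairs.++⁺ P₁.distinctSources (All.map (apart refl) side₂ ∷ P₂.distinctSources) sources-across
            ; sourcesAvoidEnd = All.++⁺ (All.map (λ a-side → apart a-side y-side) side₁) (apart refl y-side ∷ P₂.sourcesAvoidEnd)
            ; early           = All.++⁺ (All.map m<n⇒m<1+n P₁.early) (d<1+k ∷ All.map m<n⇒m<1+n P₂.early) }
            where
            module P₁ = SimplePath P₁
            module P₂ = SimplePath P₂
            walk₁ = walk-component S P₁.arcs P₁.walk P₁.early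
            walk₂ = walk-component S P₂.arcs P₂.walk P₂.early

            side₁ : All (λ a → component (source a) ≡ component (source d)) P₁.arcs
            side₁ = All.map (λ s → trans s (sym (proj₂ walk₁))) (proj₁ walk₁)
            side₂ : All (λ b → component (source b) ≡ component (target d)) P₂.arcs
            side₂ = proj₁ walk₂
            y-side : component y ≡ component (target d)
            y-side = proj₂ walk₂

            apart : ∀ {u w} → component u ≡ component (source d) → component w ≡ component (target d) → ¬ u ≡ w
            apart u-side w-side refl = split (trans (sym u-side) w-side)

            edges-apart : ∀ {a b} → Early k a → Early k b → component (source a) ≡ component (source d) →
                          component (source b) ≡ component (target d) → ¬ proj₁ a ≡ proj₁ b
            edges-apart {a} {b} a<k b<k a-side b-side same-edge =
              split (trans (sym a-side) (trans (sym (component-head S a a<k))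
                (trans (cong (component ∘ hd) same-edge) (trans (component-head S b b<k) b-side))))

            d-edge-fresh : All (λ b → ¬ proj₁ d ≡ proj₁ b) P₂.arcs
            d-edge-fresh = All.map (λ {b} b<k d≡b → old≢new b b<k (trans (sym d≡b) d-new)) P₂.early

            edges-across : All (λ a → All (λ b → ¬ proj₁ a ≡ proj₁ b) (d ∷ P₂.arcs)) P₁.arcs
            edges-across = All.zipWith (λ {a} (a<k , a-side) →
              (λ a≡d → old≢new a a<k (trans a≡d d-new)) ∷
              All.zipWith (λ {b} (b<k , b-side) → edges-apart {a} {b} a<k b<k a-side b-side) (P₂.early , side₂))
              (P₁.early , side₁)

            sources-across : All (λ a → All (λ b → ¬ source a ≡ source b) (d ∷ P₂.arcs)) P₁.arcs
            sources-across = All.zipWith (λ (avoids , a-side) → avoids ∷ All.map (apart a-side) side₂)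
                               (P₁.sourcesAvoidEnd , side₁)

            d<1+k : Early (suc k) d
            d<1+k = subst (_< suc k) (sym (trans (cong toℕ d-new) e≡k)) ≤-refl

        connected′ : ∀ x y → component′ x ≡ component′ y → SimplePath (suc k) x y
        connected′ x y same′ = bySide (component x Fin.≟ component (hd e)) (component y Fin.≟ component (hd e))
          where
          bySide : Dec (InHead x) → Dec (InHead y) → SimplePath (suc k) x y
          bySide (yes x-in) (yes y-in) = raise (connected x y (trans x-in (sym y-in)))
          bySide (no x-out) (no y-out) =
            raise (connected x y (trans (sym (proj₁ (kept x x-out))) (trans same′ (proj₁ (kept y y-out)))))
          bySide (yes x-in) (no y-out) = join (e , false) refl (separate ∘ sym) (connected x (hd e) x-in)
            (connected (tl e) y (trans (sym (proj₁ (moved x x-in))) (trans same′ (proj₁ (kept y y-out)))))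
          bySide (no x-out) (yes y-in) = join (e , true) refl separate
            (connected x (tl e) (trans (sym (proj₁ (kept x x-out))) (trans same′ (proj₁ (moved y y-in)))))
            (connected (hd e) y (sym y-in))

        joined : PartialSwitching (suc k)
        joined = record { component = component′ ; potential = potential′ ; consistent = consistent′ ; connected = connected′ }

    extend : ∀ {k} → k < nE → PartialSwitching k → PartialSwitching (suc k)
    extend {k} k<n S = extendBy (component (tl e) Fin.≟ component (hd e))
      where
      open PartialSwitching S
      e = fromℕ< k<n
      open Extend S e (toℕ-fromℕ< k<n)
      extendBy : Dec (component (tl e) ≡ component (hd e)) → PartialSwitching (suc k)
      extendBy (yes same)     = close same
      extendBy (no  separate) = Join.joined separate

    partialSwitching : ∀ k → k ≤ nE → PartialSwitching k
    partialSwitching zero    _   = empty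
    partialSwitching (suc k) k<n = extend k<n (partialSwitching k (≤-trans (n≤1+n k) k<n))

    switching : Σ (Fin nV → Bool) λ s → ∀ e → lab e ≡ s (hd e) xor s (tl e)
    switching = potential , λ e → proj₂ (consistent e (toℕ<n e))
      where open PartialSwitching (partialSwitching nE ≤-refl)

-- Planar rotation systems and even frameworks

module Equivalence (C : TwoComplex) where
  open Complex C
  open GraphTheory using (Rotation; Planar)
  open Reversal using (reverse; reverse-planar)
  open Links C
  open Switching C using (EvenOnCycles; switching)

  countTrue-cong : ∀ {n} {f g : Fin n → Bool} → (∀ i → f i ≡ g i) → countTrue f ≡ countTrue g
  countTrue-cong f≗g = cong length
    (filter-≐ (T? ∘ _) (T? ∘ _) ((λ {i} → subst T (f≗g i)) , (λ {i} → subst T (sym (f≗g i)))) (allFin _))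

  countTrue-false : ∀ n → countTrue {n} (λ _ → false) ≡ 0
  countTrue-false n = cong length (filter-none (T? ∘ λ _ → false) (All.universal (λ _ ()) (allFin n)))

  allGreen-even : (Φ : RotationFramework) → (∀ e → RotatorsReverse (RotationFramework.rot Φ) e) → IsEven Φ
  allGreen-even Φ green Z =
    (λ _ → false) , (λ i → (λ ()) , (λ red → ⊥-elim (red (green _)))) , 0 , countTrue-false (suc (Cycle.len Z))

  module _ (Φ : RotationFramework) where
    open RotationFramework Φ

    red : Fin nE → Bool
    red e = not (does (reverseRotators? e (rot (hd e)) (rot (tl e))))

    private
      module _ {e : Fin nE} where
        classifyBy : (reversed? : Dec (RotatorsReverse rot e)) → RotatorsEqual rot e ⊎ RotatorsReverse rot e →
          not (does reversed?) ≡ false × RotatorsReverse rot e ⊎ not (does reversed?) ≡ true × RotatorsEqual rot e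
        classifyBy (yes reversed) _              = inj₁ (refl , reversed)
        classifyBy (no ¬reversed) (inj₁ equal)    = inj₂ (refl , equal)
        classifyBy (no ¬reversed) (inj₂ reversed) = ⊥-elim (¬reversed reversed)

        colourBy : (reversed? : Dec (RotatorsReverse rot e)) → ∀ b → (b ≡ true → Red rot e) → (Red rot e → b ≡ true) →
          b ≡ not (does reversed?)
        colourBy (yes reversed) true  red⇒ _ = ⊥-elim (red⇒ refl reversed)
        colourBy (yes reversed) false _    _ = refl
        colourBy (no ¬reversed) b     _  ⇒red = ⇒red ¬reversed

    classify : ∀ e → red e ≡ false × RotatorsReverse rot e ⊎ red e ≡ true × RotatorsEqual rot e
    classify e = classifyBy (reverseRotators? e (rot (hd e)) (rot (tl e))) (compatible e)

    red-even : IsEven Φ → EvenOnCycles red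
    red-even even Z =
      let (colour , colour-red , m , count) = even Z
          e = Cycle.cedge Z
      in m , trans (countTrue-cong λ i → sym (colourBy (reverseRotators? (e i) (rot (hd (e i))) (rot (tl (e i)))) (colour i)
                                                        (proj₁ (colour-red i)) (proj₂ (colour-red i)))) count

    switched : (Fin nV → Bool) → ∀ v → Rotation (L v)
    switched s v = if s v then reverse (L v) (rot v) else rot v

    switched-planar : ∀ s v → Planar (L v) (switched s v)
    switched-planar s v with s v
    ... | true  = reverse-planar (L v) (rot v) (planar v)
    ... | false = planar v

    switched-green : ∀ s → (∀ e → red e ≡ s (hd e) xor s (tl e)) → ∀ e → RotatorsReverse (switched s) e
    switched-green s balanced e with s (hd e) | s (tl e) | red e | classify e | balanced e
    ... | false | false | false | inj₁ (_ , reversed) | _ = reversed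
    ... | true  | true  | false | inj₁ (_ , reversed) | _ = reverse-reverse (rot (hd e)) (rot (tl e)) reversed
    ... | true  | false | true  | inj₂ (_ , equal)    | _ = equal-reverseˡ (rot (hd e)) (rot (tl e)) equal
    ... | false | true  | true  | inj₂ (_ , equal)    | _ = equal-reverseʳ (rot (hd e)) (rot (tl e)) equal
    ... | _     | _     | false | inj₂ (() , _)       | _
    ... | _     | _     | true  | inj₁ (() , _)       | _
    ... | false | false | true  | _                   | ()
    ... | true  | true  | true  | _                   | ()
    ... | true  | false | false | _                   | ()
    ... | false | true  | false | _                   | ()

  planar⇒evenFramework : Σ (Fin nC → Fin nC) PlanarRotationSystem → Σ RotationFramework IsEven
  planar⇒evenFramework (ρ , planar) = let (Φ , green) = inducedFramework ρ planar in Φ , allGreen-even Φ green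

  evenFramework⇒planar : Σ RotationFramework IsEven → Σ (Fin nC → Fin nC) PlanarRotationSystem
  evenFramework⇒planar (Φ , even) =
    let (s , balanced) = switching (red Φ) (red-even Φ even)
        open AllGreen (switched Φ s) (switched-green Φ s balanced)
    in ρ , ρ-rotationSystem , λ v → switched Φ s v , ρ-induced v , switched-planar Φ s v

mainTheorem11 : (C : TwoComplex) → let open Complex C in
    (∀ (e : Fin nE) → 3 ≤ facesAt e) →
    (Σ (Fin nC → Fin nC) PlanarRotationSystem) ⇔ (Σ RotationFramework IsEven)
mainTheorem11 C _ = mk⇔ planar⇒evenFramework evenFramework⇒planar
  where open Equivalence C
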